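{- Let $G$ be a finite simple connected graph with diameter $d$ and let $k\ge 0$ be an integer. Then $\tau_k(G)=1$ if and only if $k\ge d-1$.
   Context: For $X\subseteq V(G)$, vertices $u,v$ are $(X,k)$-visible if some shortest $(u,v)$-path in $G$ has at most $k$ internal vertices in $X$; $X$ is a mutual $k$-visible set if every pair of distinct vertices of $X$ is $(X,k)$-visible. A mutual $k$-visibility cover of $G$ is a partition of $V(G)$ in which every part is a mutual $k$-visible set in $G$; $\tau_k(G)$ is the minimum number of parts of a mutual $k$-visibility cover of $G$. -}

module Defs where

open import Data.Nat using (ℕ; zero; suc; _+_; _≤_)
open import Data.Bool using (Bool; true; false; T; if_then_else_)
open import Data.Fin using (Fin; _≟_)
open import Data.Fin.Subset using (Subset; _∈_)
open import Data.Vec using (lookup; tabulate)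
open import Data.Product using (Σ; ∃; ∃-syntax; _×_)
open import Relation.Nullary using (¬_)
open import Relation.Nullary.Decidable using (⌊_⌋)
open import Relation.Binary.PropositionalEquality using (_≡_; _≢_)

record Graph : Set where
  field
    n     : ℕ
    adj   : Fin n → Fin n → Bool
    sym   : ∀ u v → adj u v ≡ adj v u
    irrefl : ∀ u → adj u u ≡ false

module _ (G : Graph) where
  open Graph G

  Adj : Fin n → Fin n → Set
  Adj u v = T (adj u v)

  data Walk : Fin n → Fin n → ℕ → Set where
    here : ∀ {u} → Walk u u 0
    step : ∀ {u w v ℓ} → Adj u w → Walk w v ℓ → Walk u v (suc ℓ)

  Dist : Fin n → Fin n → ℕ → Set
  Dist u v d = Walk u v d × (∀ m → Walk u v m → d ≤ m)

  IsShortest : ∀ {u v ℓ} → Walk u v ℓ → Set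
  IsShortest {u} {v} {ℓ} _ = ∀ m → Walk u v m → ℓ ≤ m

  Connected : Set
  Connected = ∀ u v → ∃[ ℓ ] Walk u v ℓ

  HasDiameter : ℕ → Set
  HasDiameter d =
    (∀ u v → ∃[ e ] (Dist u v e × e ≤ d)) × (∃[ u ] ∃[ v ] Dist u v d)

  internalIn : Subset n → ∀ {u v ℓ} → Walk u v ℓ → ℕ
  internalIn X here = 0
  internalIn X (step _ here) = 0
  internalIn X (step {w = w} _ p@(step _ _)) =
    (if lookup X w then 1 else 0) + internalIn X p

  Visible : Subset n → ℕ → Fin n → Fin n → Set
  Visible X k u v =
    ∃[ ℓ ] Σ (Walk u v ℓ) (λ p → IsShortest p × internalIn X p ≤ k)

  MutualVisible : ℕ → Subset n → Set
  MutualVisible k X = ∀ u v → u ∈ X → v ∈ X → u ≢ v → Visible X k u v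

  part : ∀ {c} → (Fin n → Fin c) → Fin c → Subset n
  part f i = tabulate (λ v → ⌊ f v ≟ i ⌋)

  Cover : ℕ → ℕ → Set
  Cover k c = Σ (Fin n → Fin c) (λ f →
    (∀ i → ∃[ v ] f v ≡ i) × (∀ i → MutualVisible k (part f i)))

  IsTau : ℕ → ℕ → Set
  IsTau k t = Cover k t × (∀ c → Cover k c → t ≤ c)

{-# OPTIONS --safe #-}
-- A shortest path with ℓ edges has ℓ ∸ 1 internal vertices, and ℓ ≤ d.  Hence for
-- k ≥ d ∸ 1 every vertex set, in particular V(G), is mutual k-visible, and the
-- one-part partition is a cover.  Conversely, if V(G) is mutual k-visible, then a
-- diametral pair u ≠ v is joined by a shortest path all of whose d ∸ 1 internal
-- vertices lie in V(G), so d ∸ 1 ≤ k.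
module Submission where

open import Defs
open import Data.Nat using (ℕ; zero; suc; _+_; _≤_; _∸_; z≤n; s≤s)
open import Data.Nat.Properties using (≤-trans; ≤-antisym; +-mono-≤; ∸-monoˡ-≤)
open import Data.Bool using (Bool; true; false; if_then_else_)
open import Data.Fin using (Fin; zero; _≟_)
open import Data.Fin.Subset using (_∈_)
open import Data.Vec using (lookup)
open import Data.Vec.Properties using (lookup∘tabulate; lookup⇒[]=; []=⇒lookup)
open import Data.Product using (_,_)
open import Function.Bundles using (_⇔_; mk⇔)
open import Relation.Nullary.Decidable using (⌊_⌋)
open import Relation.Binary.PropositionalEquality using (_≡_; _≢_; refl; trans; cong)

module _ (G : Graph) where
  open Graph G

  private
    indicator≤1 : (b : Bool) → (if b then 1 else 0) ≤ 1
    indicator≤1 true  = s≤s z≤n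
    indicator≤1 false = z≤n

  internalIn≤length∸1 : ∀ X {u v ℓ} (p : Walk G u v ℓ) → internalIn G X p ≤ ℓ ∸ 1
  internalIn≤length∸1 X here          = z≤n
  internalIn≤length∸1 X (step _ here) = z≤n
  internalIn≤length∸1 X (step {w = w} _ p@(step _ _)) =
    +-mono-≤ (indicator≤1 (lookup X w)) (internalIn≤length∸1 X p)

  internalIn-full : ∀ {X} → (∀ w → w ∈ X) →
                    ∀ {u v ℓ} (p : Walk G u v ℓ) → internalIn G X p ≡ ℓ ∸ 1
  internalIn-full X-full here          = refl
  internalIn-full X-full (step _ here) = refl
  internalIn-full {X} X-full (step {w = w} _ p@(step _ _)) =
    trans (cong (λ b → (if b then 1 else 0) + internalIn G X p) ([]=⇒lookup (X-full w)))
          (cong suc (internalIn-full X-full p))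

  shortest-length : ∀ {u v d ℓ} → Dist G u v d →
                    (p : Walk G u v ℓ) → IsShortest G p → ℓ ≡ d
  shortest-length (q , q-shortest) p p-shortest =
    ≤-antisym (p-shortest _ q) (q-shortest _ p)

  Dist-suc⇒≢ : ∀ {u v e} → Dist G u v (suc e) → u ≢ v
  Dist-suc⇒≢ (_ , minimal) refl with minimal 0 here
  ... | ()

  every-set-mutualVisible : ∀ {d k} → HasDiameter G d → d ∸ 1 ≤ k →
                            ∀ X → MutualVisible G k X
  every-set-mutualVisible (bounded , _) d∸1≤k X u v _ _ _
    with bounded u v
  ... | e , (p , p-shortest) , e≤d =
    e , p , p-shortest ,
    ≤-trans (internalIn≤length∸1 X p) (≤-trans (∸-monoˡ-≤ 1 e≤d) d∸1≤k)

  full-mutualVisible⇒dist∸1≤ : ∀ {u v d k X} → Dist G u v d →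
                               MutualVisible G k X → (∀ w → w ∈ X) → d ∸ 1 ≤ k
  full-mutualVisible⇒dist∸1≤ {d = zero}  _    _          _      = z≤n
  full-mutualVisible⇒dist∸1≤ {u} {v} {d = suc _} uv-dist X-visible X-full
    with X-visible u v (X-full u) (X-full v) (Dist-suc⇒≢ uv-dist)
  ... | _ , p , p-shortest , few-internal
    rewrite internalIn-full X-full p | shortest-length uv-dist p p-shortest = few-internal

  part-Fin1-full : (f : Fin n → Fin 1) → ∀ w → w ∈ part G f zero
  part-Fin1-full f w =
    lookup⇒[]= w _ (trans (lookup∘tabulate (λ v → ⌊ f v ≟ zero ⌋) w) (is-zero (f w)))
    where
    is-zero : (i : Fin 1) → ⌊ i ≟ zero ⌋ ≡ true
    is-zero zero = refl

  one-part-cover : ∀ {k} → Fin n → (∀ X → MutualVisible G k X) → Cover G k 1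
  one-part-cover v all-visible = (λ _ → zero) , (λ { zero → v , refl }) , (λ _ → all-visible _)

  cover⇒1≤parts : ∀ {k c} → Fin n → Cover G k c → 1 ≤ c
  cover⇒1≤parts {c = zero}  v (f , _) with f v
  ... | ()
  cover⇒1≤parts {c = suc _} _ _ = s≤s z≤n

proposition8p6 : (G : Graph) → Connected G → (d : ℕ) → HasDiameter G d →
    (k : ℕ) → IsTau G k 1 ⇔ (d ∸ 1 ≤ k)
proposition8p6 G _ d diameter@(_ , u₀ , _ , diametral) k = mk⇔ to from
  where
  to : IsTau G k 1 → d ∸ 1 ≤ k
  to ((f , _ , parts-visible) , _) =
    full-mutualVisible⇒dist∸1≤ G diametral (parts-visible zero) (part-Fin1-full G f)

  from : d ∸ 1 ≤ k → IsTau G k 1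
  from d∸1≤k =
    one-part-cover G u₀ (every-set-mutualVisible G diameter d∸1≤k) ,
    λ _ → cover⇒1≤parts G u₀
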